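{- Let $G$ be a connected non-bipartite quadrangulation of a surface in which every $4$-cycle bounds a face. Then either $G\cong K_{2,3}$, or $G$ contains no subgraph isomorphic to $K_{2,3}$ and there are no two distinct vertices $a,b$ of $G$ with $N(b)\subseteq N(a)$.
   Context: A surface is a connected compact Hausdorff space locally homeomorphic to an open disc. A quadrangulation of a surface is a graph embedded in the surface such that the boundary of each face is a $4$-cycle. $N(v)$ denotes the set of neighbors of a vertex $v$. -}

module Defs where

open import Data.Nat using (ℕ)
open import Data.Fin using (Fin; zero; suc)
open import Data.Bool using (Bool; true; false)
open import Data.List using (List; _∷_; [])
open import Data.List.Membership.Propositional using (_∈_)
open import Data.Product using (Σ; _×_; ∃; ∃-syntax)
open import Data.Sum using (_⊎_)
open import Data.Empty using (⊥)
open import Relation.Nullary using (¬_)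
open import Relation.Binary.PropositionalEquality using (_≡_; _≢_)
open import Function.Definitions using (Injective)

-- Reflexive-transitive closure of the relation "y = g x" for g in a list
-- of functions: y lies in the orbit of x under the monoid (here group,
-- since the generators are involutions) generated by the list.
data Reach {F : ℕ} (gs : List (Fin F → Fin F)) : Fin F → Fin F → Set where
  here : ∀ {x} → Reach gs x x
  step : ∀ {x y} (g : Fin F → Fin F) → g ∈ gs → Reach gs (g x) y → Reach gs x y

-- A combinatorial (flag) map with F flags: the standard combinatorial
-- encoding of a 2-cell embedding of a graph in a closed surface
-- (orientable or not).  Vertices are ⟨a1,a2⟩-orbits, edges ⟨a0,a2⟩-orbits,
-- faces ⟨a0,a1⟩-orbits.
record EmbeddedGraph (n : ℕ) : Set where
  field
    F    : ℕ
    a0 a1 a2 : Fin F → Fin F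
    a0-inv : ∀ x → a0 (a0 x) ≡ x
    a1-inv : ∀ x → a1 (a1 x) ≡ x
    a2-inv : ∀ x → a2 (a2 x) ≡ x
    a0-fpf : ∀ x → a0 x ≢ x
    a1-fpf : ∀ x → a1 x ≢ x
    a2-fpf : ∀ x → a2 x ≢ x
    a02-comm : ∀ x → a0 (a2 x) ≡ a2 (a0 x)
    a02-fpf  : ∀ x → a0 (a2 x) ≢ x
    -- the surface is connected: the generated group acts transitively
    transitive : ∀ x y → Reach (a0 ∷ a1 ∷ a2 ∷ []) x y
    vert : Fin F → Fin n
    vert-surj : ∀ u → ∃[ x ] vert x ≡ u
    vert-orbit : ∀ x y → vert x ≡ vert y → Reach (a1 ∷ a2 ∷ []) x y
    orbit-vert : ∀ x y → Reach (a1 ∷ a2 ∷ []) x y → vert x ≡ vert y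

  Adj : Fin n → Fin n → Set
  Adj u w = ∃[ x ] (vert x ≡ u × vert (a0 x) ≡ w)

  -- face rotation: consecutive flags of the face walk
  rot : Fin F → Fin F
  rot x = a1 (a0 x)

open EmbeddedGraph public

-- The underlying graph is simple: no loops, no parallel edges.
Simple : ∀ {n} → EmbeddedGraph n → Set
Simple G = (∀ x → vert G x ≢ vert G (a0 G x))
         × (∀ x y → vert G x ≡ vert G y → vert G (a0 G x) ≡ vert G (a0 G y)
                  → (y ≡ x ⊎ y ≡ a2 G x))

Distinct4 : ∀ {n} → Fin n → Fin n → Fin n → Fin n → Set
Distinct4 p q r s = p ≢ q × p ≢ r × p ≢ s × q ≢ r × q ≢ s × r ≢ s

FaceIs : ∀ {n} (G : EmbeddedGraph n) → Fin (F G) → Fin n → Fin n → Fin n → Fin n → Set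
FaceIs G x p q r s =
  vert G x ≡ p × vert G (rot G x) ≡ q
  × vert G (rot G (rot G x)) ≡ r × vert G (rot G (rot G (rot G x))) ≡ s

Quadrangulation : ∀ {n} → EmbeddedGraph n → Set
Quadrangulation G = ∀ x →
  rot G (rot G (rot G (rot G x))) ≡ x
  × Distinct4 (vert G x) (vert G (rot G x)) (vert G (rot G (rot G x)))
              (vert G (rot G (rot G (rot G x))))

FourCycle : ∀ {n} → EmbeddedGraph n → Fin n → Fin n → Fin n → Fin n → Set
FourCycle G p q r s = Distinct4 p q r s
  × Adj G p q × Adj G q r × Adj G r s × Adj G s p

EveryFourCycleBoundsFace : ∀ {n} → EmbeddedGraph n → Set
EveryFourCycleBoundsFace G = ∀ p q r s → FourCycle G p q r s →
  ∃[ x ] FaceIs G x p q r s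

Bipartite : ∀ {n} → EmbeddedGraph n → Set
Bipartite {n} G = Σ (Fin n → Bool) λ c → ∀ u w → Adj G u w → c u ≢ c w

inSmallPart : Fin 5 → Bool
inSmallPart zero = true
inSmallPart (suc zero) = true
inSmallPart _ = false

K23Adj : Fin 5 → Fin 5 → Set
K23Adj i j = inSmallPart i ≢ inSmallPart j

IsoK23 : ∀ {n} → EmbeddedGraph n → Set
IsoK23 {n} G = Σ (Fin n → Fin 5) λ f → Σ (Fin 5 → Fin n) λ g →
  (∀ u → g (f u) ≡ u) × (∀ i → f (g i) ≡ i)
  × (∀ u w → Adj G u w → K23Adj (f u) (f w))
  × (∀ u w → K23Adj (f u) (f w) → Adj G u w)

HasK23Subgraph : ∀ {n} → EmbeddedGraph n → Set
HasK23Subgraph {n} G = Σ (Fin 5 → Fin n) λ h →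
  Injective _≡_ _≡_ h × (∀ i j → K23Adj i j → Adj G (h i) (h j))

NbhdSubset : ∀ {n} → EmbeddedGraph n → Fin n → Fin n → Set
NbhdSubset G b a = ∀ w → Adj G b w → Adj G a w

{-# OPTIONS --safe #-}
-- Every configuration in question forces G to be bipartite, which is excluded (and since K₂,₃ is
-- bipartite, the first alternative never occurs).  The common mechanism: take vertices h i coloured
-- col i such that, whenever a flag runs along an edge h i → h j with col i ≠ col j, turning to the
-- next edge around h i (applying a1) again leads to a vertex of the opposite colour.  As a0 and a2
-- preserve this property too, connectivity spreads it to every flag, so col is a proper
-- 2-colouring.  By simplicity only two flags leave a given end of an edge, one on each of its two
-- faces, so the turn is read off these faces.  This applies to a 4-cycle bounding two distinct
-- faces, and to a K₂,₃: each of its edges lies on two of its 4-cycles, which bound faces.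
-- If N(b) ⊆ N(a), let b w₁ c w₂ and b w₁ c′ w₂′ be the two faces at an edge b w₁.  If w₂ ≠ w₂′
-- then a, b and w₁, w₂, w₂′ span a K₂,₃; if c ≠ a then w₁, w₂ and a, b, c do (likewise for c′);
-- otherwise both faces are bounded by the 4-cycle b w₁ a w₂.
module Submission where

open import Defs
open import Data.Nat using (ℕ)
open import Data.Bool using (Bool; true; false)
import Data.Bool as Bool
open import Data.Fin using (Fin; suc; _≟_)
open import Data.Fin.Patterns using (0F; 1F; 2F; 3F; 4F)
open import Data.Fin.Properties using (any?)
open import Data.List using (List; _∷_; [])
open import Data.List.Membership.Propositional using (_∈_)
open import Data.List.Relation.Unary.Any using (here; there)
open import Data.Vec using (Vec; _∷_; []; lookup)
open import Data.Vec.Relation.Unary.All using (All; []; _∷_)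
import Data.Vec.Relation.Unary.All as All
open import Data.Vec.Relation.Unary.All.Properties using (lookup⁺)
open import Data.Vec.Relation.Unary.AllPairs using ([]; _∷_)
open import Data.Vec.Relation.Unary.Unique.Propositional using (Unique)
open import Data.Vec.Relation.Unary.Unique.Propositional.Properties using (lookup-injective)
open import Data.Product using (_×_; _,_; proj₁; proj₂; map; uncurry; ∃₂; ∃-syntax)
open import Data.Sum using (_⊎_; inj₁; inj₂; [_,_]′; reduce)
open import Function using (_∘_)
open import Function.Definitions using (Injective)
open import Relation.Nullary using (¬_; Dec; yes; no; ¬?; _×-dec_; contradiction)
open import Relation.Nullary.Decidable using (True; toWitness)
open import Relation.Binary.PropositionalEquality
  using (_≡_; _≢_; refl; sym; trans; cong; cong₂; ≢-sym; module ≡-Reasoning)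

Reach-preserves : ∀ {F} {gs : List (Fin F → Fin F)} (P : Fin F → Set)
  → (∀ {g} → g ∈ gs → ∀ {x} → P x → P (g x))
  → ∀ {x y} → Reach gs x y → P x → P y
Reach-preserves P preserves here            px = px
Reach-preserves P preserves (step g g∈gs r) px = Reach-preserves P preserves r (preserves g∈gs px)

module _ {m n} {A : Set} (h : Fin m → Fin n) (h-injective : Injective _≡_ _≡_ h) where

  extend : A → (Fin m → A) → Fin n → A
  extend default f u with any? (λ i → h i ≟ u)
  ... | yes (i , _) = f i
  ... | no _        = default

  extend-∘ : ∀ default f i → extend default f (h i) ≡ f i
  extend-∘ default f i with any? (λ j → h j ≟ h i)
  ... | yes (j , hj≡hi) = cong f (h-injective hj≡hi)
  ... | no ∄j           = contradiction (i , refl) ∄j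

K23Square : Fin 5 → Fin 5 → Fin 5 → Fin 5 → Set
K23Square i j k l = Distinct4 i j k l × K23Adj i j × K23Adj j k × K23Adj k l × K23Adj l i

K23Adj? : ∀ i j → Dec (K23Adj i j)
K23Adj? i j = ¬? (inSmallPart i Bool.≟ inSmallPart j)

K23Square? : ∀ i j k l → Dec (K23Square i j k l)
K23Square? i j k l =
  (¬? (i ≟ j) ×-dec ¬? (i ≟ k) ×-dec ¬? (i ≟ l) ×-dec ¬? (j ≟ k) ×-dec ¬? (j ≟ l) ×-dec ¬? (k ≟ l))
  ×-dec K23Adj? i j ×-dec K23Adj? j k ×-dec K23Adj? k l ×-dec K23Adj? l i

K23Square-closing : ∀ {i j k l} → K23Square i j k l → K23Adj i l
K23Square-closing (_ , _ , _ , _ , li) = ≢-sym li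

square : ∀ {i j k l} {_ : True (K23Square? i j k l)} → K23Square i j k l
square {_} {_} {_} {_} {valid} = toWitness valid

K23-edge-on-two-squares : ∀ i j → K23Adj i j →
  ∃₂ λ k₁ l₁ → ∃₂ λ k₂ l₂ → K23Square i j k₁ l₁ × K23Square i j k₂ l₂ × (k₁ , l₁) ≢ (k₂ , l₂)
K23-edge-on-two-squares 0F 2F _ = 1F , 3F , 1F , 4F , square , square , λ ()
K23-edge-on-two-squares 0F 3F _ = 1F , 2F , 1F , 4F , square , square , λ ()
K23-edge-on-two-squares 0F 4F _ = 1F , 2F , 1F , 3F , square , square , λ ()
K23-edge-on-two-squares 1F 2F _ = 0F , 3F , 0F , 4F , square , square , λ ()
K23-edge-on-two-squares 1F 3F _ = 0F , 2F , 0F , 4F , square , square , λ ()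
K23-edge-on-two-squares 1F 4F _ = 0F , 2F , 0F , 3F , square , square , λ ()
K23-edge-on-two-squares 2F 0F _ = 3F , 1F , 4F , 1F , square , square , λ ()
K23-edge-on-two-squares 3F 0F _ = 2F , 1F , 4F , 1F , square , square , λ ()
K23-edge-on-two-squares 4F 0F _ = 2F , 1F , 3F , 1F , square , square , λ ()
K23-edge-on-two-squares 2F 1F _ = 3F , 0F , 4F , 0F , square , square , λ ()
K23-edge-on-two-squares 3F 1F _ = 2F , 0F , 4F , 0F , square , square , λ ()
K23-edge-on-two-squares 4F 1F _ = 2F , 0F , 3F , 0F , square , square , λ ()
K23-edge-on-two-squares 0F 0F adj = contradiction refl adj
K23-edge-on-two-squares 0F 1F adj = contradiction refl adj
K23-edge-on-two-squares 1F 0F adj = contradiction refl adj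
K23-edge-on-two-squares 1F 1F adj = contradiction refl adj
K23-edge-on-two-squares (suc (suc _)) (suc (suc _)) adj = contradiction refl adj

module FlagMap {n : ℕ} (G : EmbeddedGraph n) where

  OnEdge : Fin (F G) → Fin n → Fin n → Set
  OnEdge x u w = vert G x ≡ u × vert G (a0 G x) ≡ w

  vert-a1 : ∀ x → vert G (a1 G x) ≡ vert G x
  vert-a1 x = sym (orbit-vert G x (a1 G x) (step (a1 G) (here refl) here))

  vert-a2 : ∀ x → vert G (a2 G x) ≡ vert G x
  vert-a2 x = sym (orbit-vert G x (a2 G x) (step (a2 G) (there (here refl)) here))

  vert-a0 : ∀ x → vert G (a0 G x) ≡ vert G (rot G x)
  vert-a0 x = sym (vert-a1 (a0 G x))

  OnEdge-a0 : ∀ {x u w} → OnEdge x u w → OnEdge (a0 G x) w u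
  OnEdge-a0 {x} (eu , ew) = ew , trans (cong (vert G) (a0-inv G x)) eu

  OnEdge-a2 : ∀ {x u w} → OnEdge x u w → OnEdge (a2 G x) u w
  OnEdge-a2 {x} (eu , ew) =
    trans (vert-a2 x) eu , trans (cong (vert G) (a02-comm G x)) (trans (vert-a2 (a0 G x)) ew)

  Adj-sym : ∀ {u w} → Adj G u w → Adj G w u
  Adj-sym (x , e) = a0 G x , OnEdge-a0 e

  a0-injective : ∀ {x y} → a0 G x ≡ a0 G y → x ≡ y
  a0-injective {x} {y} e = trans (sym (a0-inv G x)) (trans (cong (a0 G) e) (a0-inv G y))

  rot-a0a1 : ∀ x → rot G (a0 G (a1 G x)) ≡ x
  rot-a0a1 x = trans (cong (a1 G) (a0-inv G (a1 G x))) (a1-inv G x)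

  a0a1-rot : ∀ x → a0 G (a1 G (rot G x)) ≡ x
  a0a1-rot x = trans (cong (a0 G) (a1-inv G (a0 G x))) (a0-inv G x)

  rot-injective : ∀ {x y} → rot G x ≡ rot G y → x ≡ y
  rot-injective {x} {y} e = trans (sym (a0a1-rot x)) (trans (cong (a0 G ∘ a1 G) e) (a0a1-rot y))

  rot-a0 : ∀ x → rot G (a0 G x) ≡ a1 G x
  rot-a0 x = cong (a1 G) (a0-inv G x)

  FaceIs-OnEdge : ∀ {x p q r s} → FaceIs G x p q r s → OnEdge x p q
  FaceIs-OnEdge {x} (ep , eq , _) = ep , trans (vert-a0 x) eq

  vert-rot-a2 : ∀ x → vert G (rot G (a2 G x)) ≡ vert G (rot G x)
  vert-rot-a2 x = begin
    vert G (a1 G (a0 G (a2 G x))) ≡⟨ vert-a1 _ ⟩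
    vert G (a0 G (a2 G x))        ≡⟨ cong (vert G) (a02-comm G x) ⟩
    vert G (a2 G (a0 G x))        ≡⟨ vert-a2 _ ⟩
    vert G (a0 G x)               ≡⟨ vert-a0 x ⟩
    vert G (rot G x)              ∎
    where open ≡-Reasoning

module SimpleFlagMap {n : ℕ} (G : EmbeddedGraph n) (simple : Simple G) where
  open FlagMap G

  Adj⇒≢ : ∀ {u w} → Adj G u w → u ≢ w
  Adj⇒≢ (x , eu , ew) u≡w = proj₁ simple x (trans eu (trans u≡w (sym ew)))

  flags-on-edge : ∀ {g₁ g₂ x u w} → g₁ ≢ g₂ → OnEdge g₁ u w → OnEdge g₂ u w → OnEdge x u w
    → x ≡ g₁ ⊎ x ≡ g₂
  flags-on-edge {g₁} {g₂} {x} g₁≢g₂ (eu₁ , ew₁) (eu₂ , ew₂) (eu , ew)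
    with proj₂ simple g₁ x (trans eu₁ (sym eu)) (trans ew₁ (sym ew))
       | proj₂ simple g₁ g₂ (trans eu₁ (sym eu₂)) (trans ew₁ (sym ew₂))
  ... | inj₁ x≡g₁ | _         = inj₁ x≡g₁
  ... | inj₂ refl | inj₁ refl = contradiction refl g₁≢g₂
  ... | inj₂ refl | inj₂ refl = inj₂ refl

  common-neighbours⇒K23 : ∀ {a b} {ws : Vec (Fin n) 3} → a ≢ b → Unique ws
    → All (λ w → Adj G a w × Adj G b w) ws → HasK23Subgraph G
  common-neighbours⇒K23 {a} {b} {ws} a≢b ws-unique adj =
    lookup vs , lookup-injective vs-unique _ _ , edges
    where
    vs : Vec (Fin n) 5
    vs = a ∷ b ∷ ws

    vs-unique : Unique vs
    vs-unique = (a≢b ∷ All.map (Adj⇒≢ ∘ proj₁) adj) ∷ All.map (Adj⇒≢ ∘ proj₂) adj ∷ ws-unique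

    edges : ∀ i j → K23Adj i j → Adj G (lookup vs i) (lookup vs j)
    edges 0F (suc (suc t)) _ = proj₁ (lookup⁺ adj t)
    edges 1F (suc (suc t)) _ = proj₂ (lookup⁺ adj t)
    edges (suc (suc t)) 0F _ = Adj-sym (proj₁ (lookup⁺ adj t))
    edges (suc (suc t)) 1F _ = Adj-sym (proj₂ (lookup⁺ adj t))
    edges 0F 0F c = contradiction refl c
    edges 0F 1F c = contradiction refl c
    edges 1F 0F c = contradiction refl c
    edges 1F 1F c = contradiction refl c
    edges (suc (suc _)) (suc (suc _)) c = contradiction refl c

module QuadrangularFaces {n : ℕ} (G : EmbeddedGraph n) (quad : Quadrangulation G) where
  open FlagMap G

  rot³≡a0a1 : ∀ x → rot G (rot G (rot G x)) ≡ a0 G (a1 G x)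
  rot³≡a0a1 x = rot-injective (trans (proj₁ (quad x)) (sym (rot-a0a1 x)))

  module _ {x : Fin (F G)} {p q r s : Fin n} (face : FaceIs G x p q r s) where

    FaceIs-last : vert G (a0 G (a1 G x)) ≡ s
    FaceIs-last = trans (cong (vert G) (sym (rot³≡a0a1 x))) (proj₂ (proj₂ (proj₂ face)))

    FaceIs-rot : FaceIs G (rot G x) q r s p
    FaceIs-rot = proj₁ (proj₂ face) , proj₁ (proj₂ (proj₂ face)) , proj₂ (proj₂ (proj₂ face))
               , trans (cong (vert G) (proj₁ (quad x))) (proj₁ face)

    -- a0 reverses the face walk: rot (a0 x) = a1 x, and rot³ (a0 x) = a0 (a1 (a0 x)) = a0 (rot x).
    FaceIs-a0 : FaceIs G (a0 G x) q p s r
    FaceIs-a0 = proj₂ (FaceIs-OnEdge face)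
              , trans (cong (vert G) (rot-a0 x)) (trans (vert-a1 x) (proj₁ face))
              , trans (cong (vert G ∘ rot G) (rot-a0 x)) (trans (vert-a1 _) FaceIs-last)
              , trans (cong (vert G) (rot³≡a0a1 (a0 G x)))
                      (trans (vert-a0 (rot G x)) (proj₁ (proj₂ (proj₂ face))))

  FaceIs-distinct : ∀ {x p q r s} → FaceIs G x p q r s → Distinct4 p q r s
  FaceIs-distinct {x} (refl , refl , refl , refl) = proj₂ (quad x)

  FaceIs-FourCycle : ∀ {x p q r s} → FaceIs G x p q r s → FourCycle G p q r s
  FaceIs-FourCycle {x} face =
    FaceIs-distinct face
    , (x , FaceIs-OnEdge face)
    , (rot G x , FaceIs-OnEdge (FaceIs-rot face))
    , (rot G (rot G x) , FaceIs-OnEdge (FaceIs-rot (FaceIs-rot face)))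
    , (rot G (rot G (rot G x)) , FaceIs-OnEdge (FaceIs-rot (FaceIs-rot (FaceIs-rot face))))

  FaceIs-unique : ∀ {x p q r s p′ q′ r′ s′} → FaceIs G x p q r s → FaceIs G x p′ q′ r′ s′
    → r ≡ r′ × s ≡ s′
  FaceIs-unique (_ , _ , refl , refl) (_ , _ , refl , refl) = refl , refl

module SimpleQuadrangulation
  {n : ℕ} (G : EmbeddedGraph n) (simple : Simple G) (quad : Quadrangulation G) where
  open FlagMap G
  open SimpleFlagMap G simple
  open QuadrangularFaces G quad

  last-vertex-at-edge : ∀ {g₁ g₂ x p q r₁ s₁ r₂ s₂} → FaceIs G g₁ p q r₁ s₁ → FaceIs G g₂ p q r₂ s₂
    → g₁ ≢ g₂ → OnEdge x p q → vert G (a0 G (a1 G x)) ≡ s₁ ⊎ vert G (a0 G (a1 G x)) ≡ s₂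
  last-vertex-at-edge face₁ face₂ g₁≢g₂ e
    with flags-on-edge g₁≢g₂ (FaceIs-OnEdge face₁) (FaceIs-OnEdge face₂) e
  ... | inj₁ refl = inj₁ (FaceIs-last face₁)
  ... | inj₂ refl = inj₂ (FaceIs-last face₂)

  module BichromaticFlags
    {m : ℕ} (h : Fin m → Fin n) (h-injective : Injective _≡_ _≡_ h) (col : Fin m → Bool)
    (turn : ∀ i j {x} → col i ≢ col j → OnEdge x (h i) (h j)
          → ∃[ k ] (col i ≢ col k × vert G (a0 G (a1 G x)) ≡ h k)) where

    Bichromatic : Fin (F G) → Set
    Bichromatic x = ∃₂ λ i j → col i ≢ col j × OnEdge x (h i) (h j)

    Bichromatic-closed : ∀ {g} → g ∈ a0 G ∷ a1 G ∷ a2 G ∷ []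
      → ∀ {x} → Bichromatic x → Bichromatic (g x)
    Bichromatic-closed (here refl) (i , j , i≁j , e) = j , i , ≢-sym i≁j , OnEdge-a0 e
    Bichromatic-closed (there (here refl)) {x} (i , j , i≁j , e) with turn i j i≁j e
    ... | k , i≁k , ek = i , k , i≁k , trans (vert-a1 x) (proj₁ e) , ek
    Bichromatic-closed (there (there (here refl))) (i , j , i≁j , e) = i , j , i≁j , OnEdge-a2 e

    bipartite : ∀ {x₀} → Bichromatic x₀ → Bipartite G
    bipartite {x₀} b₀ = c , proper
      where
      c : Fin n → Bool
      c = extend h h-injective true col

      proper : ∀ u w → Adj G u w → c u ≢ c w
      proper u w (x , eu , ew) cu≡cw
        with Reach-preserves Bichromatic Bichromatic-closed (transitive G x₀ x) b₀
      ... | i , j , i≁j , ei , ej = i≁j (begin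
        col i     ≡⟨ sym (extend-∘ h h-injective true col i) ⟩
        c (h i)   ≡⟨ cong c (trans (sym ei) eu) ⟩
        c u       ≡⟨ cu≡cw ⟩
        c w       ≡⟨ cong c (trans (sym ew) ej) ⟩
        c (h j)   ≡⟨ extend-∘ h h-injective true col j ⟩
        col j     ∎)
        where open ≡-Reasoning

  BoundsTwoFaces : Fin n → Fin n → Fin n → Fin n → Set
  BoundsTwoFaces p q r s = ∃₂ λ g g′ → g ≢ g′ × FaceIs G g p q r s × FaceIs G g′ p q r s

  BoundsTwoFaces-rot : ∀ {p q r s} → BoundsTwoFaces p q r s → BoundsTwoFaces q r s p
  BoundsTwoFaces-rot (g , g′ , g≢g′ , face , face′) =
    rot G g , rot G g′ , g≢g′ ∘ rot-injective , FaceIs-rot face , FaceIs-rot face′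

  BoundsTwoFaces-a0 : ∀ {p q r s} → BoundsTwoFaces p q r s → BoundsTwoFaces q p s r
  BoundsTwoFaces-a0 (g , g′ , g≢g′ , face , face′) =
    a0 G g , a0 G g′ , g≢g′ ∘ a0-injective , FaceIs-a0 face , FaceIs-a0 face′

  BoundsTwoFaces-turn : ∀ {p q r s x} → BoundsTwoFaces p q r s → OnEdge x p q
    → vert G (a0 G (a1 G x)) ≡ s
  BoundsTwoFaces-turn (_ , _ , g≢g′ , face , face′) e =
    reduce (last-vertex-at-edge face face′ g≢g′ e)

  BoundsTwoFaces⇒bipartite : ∀ {p q r s} → BoundsTwoFaces p q r s → Bipartite G
  BoundsTwoFaces⇒bipartite {p} {q} {r} {s} two@(g , _ , _ , face , _) =
    bipartite (0F , 1F , (λ ()) , FaceIs-OnEdge face)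
    where
    h : Fin 4 → Fin n
    h = lookup (p ∷ q ∷ r ∷ s ∷ [])

    h-injective : Injective _≡_ _≡_ h
    h-injective with FaceIs-distinct face
    ... | p≢q , p≢r , p≢s , q≢r , q≢s , r≢s =
      lookup-injective ((p≢q ∷ p≢r ∷ p≢s ∷ []) ∷ (q≢r ∷ q≢s ∷ []) ∷ (r≢s ∷ []) ∷ [] ∷ []) _ _

    col : Fin 4 → Bool
    col = lookup (true ∷ false ∷ true ∷ false ∷ [])

    two₁ : BoundsTwoFaces q r s p
    two₁ = BoundsTwoFaces-rot two

    two₂ : BoundsTwoFaces r s p q
    two₂ = BoundsTwoFaces-rot two₁

    two₃ : BoundsTwoFaces s p q r
    two₃ = BoundsTwoFaces-rot two₂

    turn : ∀ i j {x} → col i ≢ col j → OnEdge x (h i) (h j)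
         → ∃[ k ] (col i ≢ col k × vert G (a0 G (a1 G x)) ≡ h k)
    turn 0F 1F _ e = 3F , (λ ()) , BoundsTwoFaces-turn two e
    turn 1F 2F _ e = 0F , (λ ()) , BoundsTwoFaces-turn two₁ e
    turn 2F 3F _ e = 1F , (λ ()) , BoundsTwoFaces-turn two₂ e
    turn 3F 0F _ e = 2F , (λ ()) , BoundsTwoFaces-turn two₃ e
    turn 1F 0F _ e = 2F , (λ ()) , BoundsTwoFaces-turn (BoundsTwoFaces-a0 two) e
    turn 2F 1F _ e = 3F , (λ ()) , BoundsTwoFaces-turn (BoundsTwoFaces-a0 two₁) e
    turn 3F 2F _ e = 0F , (λ ()) , BoundsTwoFaces-turn (BoundsTwoFaces-a0 two₂) e
    turn 0F 3F _ e = 1F , (λ ()) , BoundsTwoFaces-turn (BoundsTwoFaces-a0 two₃) e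
    turn 0F 0F i≁j _ = contradiction refl i≁j
    turn 0F 2F i≁j _ = contradiction refl i≁j
    turn 1F 1F i≁j _ = contradiction refl i≁j
    turn 1F 3F i≁j _ = contradiction refl i≁j
    turn 2F 0F i≁j _ = contradiction refl i≁j
    turn 2F 2F i≁j _ = contradiction refl i≁j
    turn 3F 1F i≁j _ = contradiction refl i≁j
    turn 3F 3F i≁j _ = contradiction refl i≁j

    open BichromaticFlags h h-injective col turn

  K23-subgraph⇒bipartite : EveryFourCycleBoundsFace G → HasK23Subgraph G → Bipartite G
  K23-subgraph⇒bipartite every4 (h , h-injective , h-adj) =
    bipartite (0F , 2F , (λ ()) , proj₂ (h-adj 0F 2F (λ ())))
    where
    square⇒FourCycle : ∀ {i j k l} → K23Square i j k l → FourCycle G (h i) (h j) (h k) (h l)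
    square⇒FourCycle ((i≢j , i≢k , i≢l , j≢k , j≢l , k≢l) , ij , jk , kl , li) =
      (i≢j ∘ h-injective , i≢k ∘ h-injective , i≢l ∘ h-injective
      , j≢k ∘ h-injective , j≢l ∘ h-injective , k≢l ∘ h-injective)
      , h-adj _ _ ij , h-adj _ _ jk , h-adj _ _ kl , h-adj _ _ li

    faces-differ : ∀ {g₁ g₂ i j k₁ l₁ k₂ l₂} → FaceIs G g₁ (h i) (h j) (h k₁) (h l₁)
      → FaceIs G g₂ (h i) (h j) (h k₂) (h l₂) → (k₁ , l₁) ≢ (k₂ , l₂) → g₁ ≢ g₂
    faces-differ face₁ face₂ kl₁≢kl₂ refl =
      kl₁≢kl₂ (uncurry (cong₂ _,_) (map h-injective h-injective (FaceIs-unique face₁ face₂)))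

    turn : ∀ i j {x} → K23Adj i j → OnEdge x (h i) (h j)
         → ∃[ k ] (K23Adj i k × vert G (a0 G (a1 G x)) ≡ h k)
    turn i j ij e with K23-edge-on-two-squares i j ij
    ... | k₁ , l₁ , k₂ , l₂ , square₁ , square₂ , kl₁≢kl₂
      with every4 _ _ _ _ (square⇒FourCycle square₁) | every4 _ _ _ _ (square⇒FourCycle square₂)
    ... | _ , face₁ | _ , face₂ with last-vertex-at-edge face₁ face₂ (faces-differ face₁ face₂ kl₁≢kl₂) e
    ...   | inj₁ e₁ = l₁ , K23Square-closing square₁ , e₁
    ...   | inj₂ e₂ = l₂ , K23Square-closing square₂ , e₂

    open BichromaticFlags h h-injective inSmallPart turn

  face-at-dominated-vertex⇒K23 : ∀ {g a b w₁ c w₂} → FaceIs G g b w₁ c w₂ → NbhdSubset G b a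
    → a ≢ b → a ≢ c → HasK23Subgraph G
  face-at-dominated-vertex⇒K23 face sub a≢b a≢c
    with FaceIs-distinct face | FaceIs-FourCycle face
  ... | _ , _ , _ , _ , w₁≢w₂ , _ | (_ , b≢c , _) , bw₁ , w₁c , cw₂ , w₂b =
    common-neighbours⇒K23 w₁≢w₂ ((a≢b ∷ a≢c ∷ []) ∷ (b≢c ∷ []) ∷ [] ∷ [])
      (  (Adj-sym (sub _ bw₁) , Adj-sym (sub _ (Adj-sym w₂b)))
       ∷ (Adj-sym bw₁ , w₂b)
       ∷ (w₁c , Adj-sym cw₂)
       ∷ [])

  dominated-vertex-with-three-neighbours⇒K23 : ∀ {x y a b w₁ c w₂ c′ w₂′}
    → FaceIs G x b w₁ c w₂ → FaceIs G y b w₁ c′ w₂′ → NbhdSubset G b a → a ≢ b → w₂ ≢ w₂′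
    → HasK23Subgraph G
  dominated-vertex-with-three-neighbours⇒K23 face face′ sub a≢b w₂≢w₂′
    with FaceIs-distinct face | FaceIs-FourCycle face | FaceIs-distinct face′ | FaceIs-FourCycle face′
  ... | _ , _ , _ , _ , w₁≢w₂ , _  | _ , bw₁ , _ , _ , w₂b
      | _ , _ , _ , _ , w₁≢w₂′ , _ | _ , _ , _ , _ , w₂′b =
    common-neighbours⇒K23 a≢b ((w₁≢w₂ ∷ w₁≢w₂′ ∷ []) ∷ (w₂≢w₂′ ∷ []) ∷ [] ∷ [])
      (All.map (λ bw → sub _ bw , bw) (bw₁ ∷ Adj-sym w₂b ∷ Adj-sym w₂′b ∷ []))

  faces-at-dominated-vertex⇒K23⊎bipartite : ∀ {x y a b w₁ c w₂ c′ w₂′} → x ≢ y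
    → FaceIs G x b w₁ c w₂ → FaceIs G y b w₁ c′ w₂′ → NbhdSubset G b a → a ≢ b
    → HasK23Subgraph G ⊎ Bipartite G
  faces-at-dominated-vertex⇒K23⊎bipartite {x} {y} {a} {c = c} {w₂} {c′} {w₂′} x≢y face face′ sub a≢b
    with w₂ ≟ w₂′ | a ≟ c | a ≟ c′
  ... | no w₂≢w₂′ | _ | _ =
    inj₁ (dominated-vertex-with-three-neighbours⇒K23 face face′ sub a≢b w₂≢w₂′)
  ... | yes refl | no a≢c | _        = inj₁ (face-at-dominated-vertex⇒K23 face sub a≢b a≢c)
  ... | yes refl | yes refl | no a≢c′ = inj₁ (face-at-dominated-vertex⇒K23 face′ sub a≢b a≢c′)
  ... | yes refl | yes refl | yes refl = inj₂ (BoundsTwoFaces⇒bipartite (x , y , x≢y , face , face′))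

  dominated-vertex⇒K23⊎bipartite : ∀ {a b} → a ≢ b → NbhdSubset G b a
    → HasK23Subgraph G ⊎ Bipartite G
  dominated-vertex⇒K23⊎bipartite {b = b} a≢b sub with vert-surj G b
  ... | x , refl = faces-at-dominated-vertex⇒K23⊎bipartite (a2-fpf G x ∘ sym)
    (refl , refl , refl , refl) (vert-a2 x , vert-rot-a2 x , refl , refl) sub a≢b

lemma3p1 : ∀ {n} (G : EmbeddedGraph n) → Simple G → Quadrangulation G
    → EveryFourCycleBoundsFace G → ¬ Bipartite G
    → IsoK23 G
      ⊎ (¬ HasK23Subgraph G × (∀ a b → a ≢ b → ¬ NbhdSubset G b a))
lemma3p1 G simple quad every4 non-bipartite = inj₂ (no-K23 , no-dominated-vertex)
  where
  open SimpleQuadrangulation G simple quad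

  no-K23 : ¬ HasK23Subgraph G
  no-K23 = non-bipartite ∘ K23-subgraph⇒bipartite every4

  no-dominated-vertex : ∀ a b → a ≢ b → ¬ NbhdSubset G b a
  no-dominated-vertex a b a≢b sub =
    [ no-K23 , non-bipartite ]′ (dominated-vertex⇒K23⊎bipartite a≢b sub)
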